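{- Let $h\colon[n]\to[n]$ be a Hessenberg function and $w\in\mathfrak S_n$ a generator for $h$. If $w$ avoids all of the associated patterns $[2143]_h$, $[1324]_h$, $[1243]_h$, $[2134]_h$, $[1423]_h$, $[2314]_h$, $[2413]_h$, then so does $\overline w$.
   Context: A Hessenberg function is a nondecreasing $h\colon[n]\to[n]$ with $h(i)\ge i$. Permutations are in one-line notation; $(a,b)u$ denotes $u$ with the values $a$ and $b$ swapped. A generator for $h$ is a $w$ with $w^{ -1}(w(i)+1)\le h(i)$ whenever $w(i)\le n-1$. $Y(w)=\{w(i)\mid i\ge w^{ -1}(1),\ w(i)\le w(n)\}=\{y_0<\cdots<y_r\}$. Define $\overline w_0=w$, $\overline w_m=(1,y_m)\overline w_{m-1}$ for $1\le m\le r$, and $\overline w=\overline w_r$. Associated patterns: $w$ contains $[2143]_h$ if $w(j)<w(i)<w(\ell)<w(k)$ for some $i<j<k<\ell\le h(i)$; $[1324]_h$ if $w(i)<w(k)<w(j)<w(\ell)$ for some $i<j<k<\ell\le h(j)$ with $k\le h(i)$; $[1243]_h$ if $w(i)<w(j)<w(\ell)<w(k)$ for some $i<j<k<\ell\le h(j)$ with $j\le h(i)<\ell$; $[2134]_h$ if $w(j)<w(i)<w(k)<w(\ell)$ for some $i<j<k<\ell\le h(k)$ with $k\le h(i)<\ell$; $[1423]_h$ if $w(i)<w(k)<w(\ell)<w(j)$ for some $i<j<k<\ell\le h(j)$ with $k\le h(i)<\ell$; $[2314]_h$ if $w(k)<w(i)<w(j)<w(\ell)$ for some $i<j<k<\ell\le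 h(j)$ with $k\le h(i)<\ell$; $[2413]_h$ if $w(k)<w(i)<w(\ell)<w(j)$ for some $i<j\le h(i)<k\le h(j)<\ell\le h(k)$. The same definitions apply to $\overline w$. -}

module Defs where

open import Data.Nat using (ℕ; suc)
open import Data.Fin using (Fin; zero; suc; toℕ; _<_; _≤_; _≤?_; _<?_; fromℕ)
open import Data.Fin.Permutation using (Permutation′; _⟨$⟩ʳ_; _⟨$⟩ˡ_; _∘ₚ_; transpose)
open import Data.List using (List; filter; foldl; drop)
open import Data.List.Base using (allFin)
open import Data.Product using (_×_; ∃-syntax)
open import Relation.Nullary using (¬_)
open import Relation.Nullary.Decidable using (_×-dec_)

-- Conventions: [n] = {1,…,n} is encoded as Fin n, with k : Fin n standing for k+1.
-- Order on Fin is the usual one (via toℕ), so all comparisons are unchanged.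

record IsHessenberg (n : ℕ) (h : Fin n → Fin n) : Set where
  field
    monotone  : ∀ {i j : Fin n} → i ≤ j → h i ≤ h j
    extensive : ∀ (i : Fin n) → i ≤ h i

-- w is a generator for h: whenever w(i) ≤ n-1 (i.e. w(i)+1 is a value in [n]),
-- w⁻¹(w(i)+1) ≤ h(i).   In 0-indexed form: whenever toℕ (w i) + 1 < n.
IsGenerator : ∀ {n} → (h : Fin n → Fin n) → Permutation′ n → Set
IsGenerator {n} h w =
  ∀ (i : Fin n) (lt : suc (toℕ (w ⟨$⟩ʳ i)) Data.Nat.< n) →
    (w ⟨$⟩ˡ Data.Fin.fromℕ< lt) ≤ h i

-- (a,b)u : u with the values a and b swapped, i.e. transposition after u.
-- (π₁ ∘ₚ π₂ applies π₁ first, then π₂.)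
swapVals : ∀ {n} → Fin n → Fin n → Permutation′ n → Permutation′ n
swapVals a b u = u ∘ₚ transpose a b

-- Y(w) = { w(i) | i ≥ w⁻¹(1), w(i) ≤ w(n) }, listed in increasing order y₀ < … < y_r.
Ylist : ∀ {n} → Permutation′ (suc n) → List (Fin (suc n))
Ylist {n} w = filter (λ v → ((w ⟨$⟩ˡ zero) ≤? (w ⟨$⟩ˡ v)) ×-dec (v ≤? (w ⟨$⟩ʳ fromℕ n)))
                     (allFin (suc n))

-- w̄ = w̄_r, where w̄_0 = w and w̄_m = (1, y_m) w̄_{m-1} for 1 ≤ m ≤ r.
wbar : ∀ {n} → Permutation′ (suc n) → Permutation′ (suc n)
wbar w = foldl (λ u y → swapVals zero y u) w (drop 1 (Ylist w))

module _ {n : ℕ} (h : Fin n → Fin n) (w : Permutation′ n) where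
  private
    W : Fin n → Fin n
    W i = w ⟨$⟩ʳ i

  Contains2143 : Set
  Contains2143 = ∃[ i ] ∃[ j ] ∃[ k ] ∃[ l ]
    (i < j × j < k × k < l × l ≤ h i ×
     W j < W i × W i < W l × W l < W k)

  Contains1324 : Set
  Contains1324 = ∃[ i ] ∃[ j ] ∃[ k ] ∃[ l ]
    (i < j × j < k × k < l × l ≤ h j × k ≤ h i ×
     W i < W k × W k < W j × W j < W l)

  Contains1243 : Set
  Contains1243 = ∃[ i ] ∃[ j ] ∃[ k ] ∃[ l ]
    (i < j × j < k × k < l × l ≤ h j × j ≤ h i × h i < l ×
     W i < W j × W j < W l × W l < W k)

  Contains2134 : Set
  Contains2134 = ∃[ i ] ∃[ j ] ∃[ k ] ∃[ l ]
    (i < j × j < k × k < l × l ≤ h k × k ≤ h i × h i < l ×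
     W j < W i × W i < W k × W k < W l)

  Contains1423 : Set
  Contains1423 = ∃[ i ] ∃[ j ] ∃[ k ] ∃[ l ]
    (i < j × j < k × k < l × l ≤ h j × k ≤ h i × h i < l ×
     W i < W k × W k < W l × W l < W j)

  Contains2314 : Set
  Contains2314 = ∃[ i ] ∃[ j ] ∃[ k ] ∃[ l ]
    (i < j × j < k × k < l × l ≤ h j × k ≤ h i × h i < l ×
     W k < W i × W i < W j × W j < W l)

  Contains2413 : Set
  Contains2413 = ∃[ i ] ∃[ j ] ∃[ k ] ∃[ l ]
    (i < j × j ≤ h i × h i < k × k ≤ h j × h j < l × l ≤ h k ×
     W k < W i × W i < W l × W l < W j)

  AvoidsAll : Set
  AvoidsAll = ¬ Contains2143 × ¬ Contains1324 × ¬ Contains1243 × ¬ Contains2134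
            × ¬ Contains1423 × ¬ Contains2314 × ¬ Contains2413

-- Write Y also for the set of positions of the elements of Y(w); its first one is q = w⁻¹(1) and its
-- last one is N = n. Composing the transpositions (1 y_m) makes w̄ shift the values on Y cyclically
-- upwards: every position of Y but N receives the next larger value of Y, N receives 1, and w̄ = w off Y.
-- Avoidance of [1324]_h together with the generator property forces w to increase along Y, so the next
-- larger value of Y sits at the next position of Y. The generator property for the value just below it,
-- with avoidance of [1324]_h and [2314]_h, keeps that position within the Hessenberg bounds valid for the
-- old one. Hence in an occurrence of a pattern in w̄ each entry can be kept or moved to the next position
-- of Y, giving an occurrence in w of the same pattern or of [2143]_h, [1324]_h or [2413]_h.

module Submission where

open import Defs
open import Data.Nat as ℕ using (ℕ; zero; suc; z≤n; _<_; _≤_; _+_; _∸_)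
open import Data.Nat.Properties
  using (<-irrefl; <-asym; <-trans; <⇒≤; ≤-trans; ≤-refl; ≤-reflexive; <⇒≱; ≰⇒>; ≤∧≢⇒<; ≤-<-trans;
         <-≤-trans; <-cmp; ≤-pred; n<1+n; ≤-antisym; m≤n+m; m∸n+n≡m; ≮⇒≥; m≤n⇒m<n∨m≡n)
open import Data.Fin as Fin using (Fin; zero; suc; toℕ; fromℕ; fromℕ<)
open import Data.Fin.Properties using (_≟_; toℕ-injective; toℕ<n; toℕ-fromℕ<; ≤fromℕ)
import Data.Fin.Properties as Finₚ
import Data.Fin.Permutation.Components as PC
open import Data.Fin.Permutation using (Permutation′; _⟨$⟩ʳ_; _⟨$⟩ˡ_; inverseˡ; inverseʳ)
open import Data.List using (List; []; _∷_; foldl; drop; filter)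
open import Data.List.Base using (allFin)
open import Data.List.Extrema.Nat using (argmax; argmax-all; f[xs]≤f[argmax])
open import Data.List.Relation.Unary.All as All using (All; []; _∷_)
open import Data.List.Relation.Unary.All.Properties using (all-filter)
open import Data.List.Relation.Unary.AllPairs using (AllPairs; []; _∷_)
import Data.List.Relation.Unary.AllPairs.Properties as AllPairs
open import Data.List.Relation.Unary.Any using (here; there)
open import Data.List.Membership.Propositional using (_∈_; _∉_)
open import Data.List.Membership.Propositional.Properties using (∈-filter⁺; ∈-filter⁻; ∈-allFin)
open import Data.List.Properties using (filter-accept)
open import Data.Product using (_×_; _,_; proj₁; proj₂; ∃; ∃₂; Σ)
open import Data.Sum using (_⊎_; inj₁; inj₂)
open import Data.Empty using (⊥; ⊥-elim)
open import Relation.Nullary using (¬_; Dec; yes; no)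
open import Relation.Nullary.Decidable using (_×-dec_; dec-true; dec-false)
open import Relation.Unary using (Pred; Decidable)
open import Relation.Binary using (tri<; tri≈; tri>)
open import Relation.Binary.PropositionalEquality using (_≡_; _≢_; refl; sym; trans; cong; subst; subst₂)

greatest : ∀ {m ℓ} {P : Pred (Fin m) ℓ} → Decidable P → (f : Fin m → ℕ) →
           ∀ {x} → P x → ∃ λ y → P y × (∀ {z} → P z → f z ≤ f y)
greatest {m} P? f {x} Px =
  argmax f x xs , argmax-all f Px (all-filter P? (allFin m)) ,
  λ Pz → All.lookup (f[xs]≤f[argmax] x xs) (∈-filter⁺ P? (∈-allFin _) Pz)
  where xs = filter P? (allFin m)

module _ {n : ℕ} where

  cycleThrough : List (Fin (suc n)) → Fin (suc n) → Fin (suc n)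
  cycleThrough []       t = t
  cycleThrough (y ∷ ys) t = cycleThrough ys (PC.transpose zero y t)

  foldl-swapVals : ∀ (u : Permutation′ (suc n)) ys x →
    foldl (λ v y → swapVals zero y v) u ys ⟨$⟩ʳ x ≡ cycleThrough ys (u ⟨$⟩ʳ x)
  foldl-swapVals u []       x = refl
  foldl-swapVals u (y ∷ ys) x = foldl-swapVals (swapVals zero y u) ys x

  transpose-zero-right : ∀ {y : Fin (suc n)} → y ≢ zero → PC.transpose zero y y ≡ zero
  transpose-zero-right {y} y≢0 rewrite dec-false (y ≟ zero) y≢0 | dec-true (y ≟ y) refl = refl

  transpose-zero-other : ∀ {y t : Fin (suc n)} → t ≢ zero → t ≢ y → PC.transpose zero y t ≡ t
  transpose-zero-other {y} {t} t≢0 t≢y rewrite dec-false (t ≟ zero) t≢0 | dec-false (t ≟ y) t≢y = refl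

  Ascending : List (Fin (suc n)) → Set
  Ascending ys = AllPairs Fin._<_ (zero ∷ ys)

  cycleThrough-fixes : ∀ {ys} → Ascending ys → ∀ {t} → t ≢ zero → t ∉ ys → cycleThrough ys t ≡ t
  cycleThrough-fixes {[]}     _                     _   _   = refl
  cycleThrough-fixes {y ∷ ys} ((_ ∷ 0<ys) ∷ _ ∷ asc) t≢0 t∉ =
    trans (cong (cycleThrough ys) (transpose-zero-other t≢0 (λ t≡y → t∉ (here t≡y))))
          (cycleThrough-fixes (0<ys ∷ asc) t≢0 (λ t∈ → t∉ (there t∈)))

  -- On an ascending list 0 < y₁ < ⋯ < y_r, cycleThrough is the cycle 0 ↦ y₁ ↦ ⋯ ↦ y_r ↦ 0.
  NextInCycle : List (Fin (suc n)) → Fin (suc n) → Fin (suc n) → Set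
  NextInCycle ys t c = (c ≡ zero × All (Fin._≤ t) ys)
                     ⊎ (c ∈ ys × t Fin.< c × (∀ {s} → s ∈ ys → t Fin.< s → c Fin.≤ s))

  cycleThrough-next : ∀ {ys} → Ascending ys → ∀ {t} → t ∈ zero ∷ ys → NextInCycle ys t (cycleThrough ys t)
  cycleThrough-next {[]}     _ (here refl) = inj₁ (refl , [])
  cycleThrough-next {y ∷ ys} ((0<y ∷ 0<ys) ∷ y<ys ∷ asc) (here refl) =
    subst (NextInCycle (y ∷ ys) zero)
      (sym (cycleThrough-fixes (0<ys ∷ asc) (λ { refl → <-irrefl refl 0<y })
                                (λ y∈ → <-irrefl refl (All.lookup y<ys y∈))))
      (inj₂ (here refl , 0<y , λ { (here refl) _ → ≤-refl ; (there s∈) _ → <⇒≤ (All.lookup y<ys s∈) }))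
  cycleThrough-next {y ∷ ys} ((0<y ∷ 0<ys) ∷ y<ys ∷ asc) (there (here refl)) =
    subst (NextInCycle (y ∷ ys) y)
      (sym (cong (cycleThrough ys) (transpose-zero-right {y} (λ { refl → <-irrefl refl 0<y }))))
      (extend (cycleThrough-next (0<ys ∷ asc) (here refl)))
    where
    extend : ∀ {c} → NextInCycle ys zero c → NextInCycle (y ∷ ys) y c
    extend (inj₁ (c≡0 , ys≤0)) = inj₁ (c≡0 , ≤-refl ∷ All.map (λ s≤0 → ≤-trans s≤0 z≤n) ys≤0)
    extend (inj₂ (c∈ , _ , least)) = inj₂ (there c∈ , All.lookup y<ys c∈ ,
      λ { (here refl) y<y → ⊥-elim (<-irrefl refl y<y) ; (there s∈) _ → least s∈ (All.lookup 0<ys s∈) })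
  cycleThrough-next {y ∷ ys} ((0<y ∷ 0<ys) ∷ y<ys ∷ asc) {t} (there (there t∈)) =
    subst (NextInCycle (y ∷ ys) t)
      (sym (cong (cycleThrough ys) (transpose-zero-other (λ { refl → <-irrefl refl (All.lookup 0<ys t∈) })
                                                         (λ { refl → <-irrefl refl y<t }))))
      (extend (cycleThrough-next (0<ys ∷ asc) (there t∈)))
    where
    y<t = All.lookup y<ys t∈
    extend : ∀ {c} → NextInCycle ys t c → NextInCycle (y ∷ ys) t c
    extend (inj₁ (c≡0 , ys≤t)) = inj₁ (c≡0 , <⇒≤ y<t ∷ ys≤t)
    extend (inj₂ (c∈ , t<c , least)) = inj₂ (there c∈ , t<c ,
      λ { (here refl) t<y → ⊥-elim (<-asym t<y y<t) ; (there s∈) t<s → least s∈ t<s })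

module YSet {n : ℕ} (w : Permutation′ (suc n)) where

  V : Fin (suc n) → ℕ
  V x = toℕ (w ⟨$⟩ʳ x)

  q N : Fin (suc n)
  q = w ⟨$⟩ˡ zero
  N = fromℕ n

  -- x is the position of an element of Y(w); values are 0-based, so q is the position of 1.
  InY : Fin (suc n) → Set
  InY x = q Fin.≤ x × V x ≤ V N

  InY? : ∀ x → Dec (InY x)
  InY? x = (toℕ q ℕ.≤? toℕ x) ×-dec (V x ℕ.≤? V N)

  Raised : Fin (suc n) → Set
  Raised x = InY x × x ≢ N

  V-injective : ∀ {a b} → V a ≡ V b → a ≡ b
  V-injective {a} {b} Va≡Vb =
    trans (sym (inverseˡ w)) (trans (cong (w ⟨$⟩ˡ_) (toℕ-injective Va≡Vb)) (inverseˡ w))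

  V-surjective : ∀ {t} → t < suc n → ∃ λ p → V p ≡ t
  V-surjective t<1+n = w ⟨$⟩ˡ fromℕ< t<1+n , trans (cong toℕ (inverseʳ w)) (toℕ-fromℕ< t<1+n)

  V[q]≡0 : V q ≡ 0
  V[q]≡0 = cong toℕ (inverseʳ w)

  q-InY : InY q
  q-InY = ≤-refl , subst (_≤ V N) (sym V[q]≡0) z≤n

  N-InY : InY N
  N-InY = ≤fromℕ q , ≤-refl

  -- W is the value function of a permutation shifting the values on Y cyclically upwards.
  record IsYShift (W : Fin (suc n) → ℕ) : Set where
    field
      fixes  : ∀ {x} → ¬ InY x → W x ≡ V x
      last   : W N ≡ 0
      raises : ∀ {x} → Raised x → V x < W x
      hits   : ∀ {x} → Raised x → ∃ λ y → InY y × V y ≡ W x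
      least  : ∀ {x z} → Raised x → InY z → V x < V z → W x ≤ V z

module _ {n : ℕ} (w : Permutation′ (suc n)) where
  open YSet w

  private
    ys : List (Fin (suc n))
    ys = drop 1 (Ylist w)

    YValue? : ∀ v → Dec (q Fin.≤ w ⟨$⟩ˡ v × v Fin.≤ w ⟨$⟩ʳ N)
    YValue? v = Fin._≤?_ q (w ⟨$⟩ˡ v) ×-dec Fin._≤?_ v (w ⟨$⟩ʳ N)

    Ylist≡ : Ylist w ≡ zero ∷ ys
    Ylist≡ = trans zero-first (cong (λ l → zero ∷ drop 1 l) (sym zero-first))
      where zero-first = filter-accept YValue? (≤-refl , z≤n)

    ys-ascending : Ascending ys
    ys-ascending = subst (AllPairs Fin._<_) Ylist≡
      (AllPairs.filter⁺ YValue? (AllPairs.tabulate⁺-< {f = λ i → i} (λ i<j → i<j)))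

    value-InY : ∀ {x} → InY x → w ⟨$⟩ʳ x ∈ zero ∷ ys
    value-InY {x} (q≤x , Vx≤VN) = subst (w ⟨$⟩ʳ x ∈_) Ylist≡
      (∈-filter⁺ YValue? (∈-allFin _) (subst (λ p → q Fin.≤ p) (sym (inverseˡ w)) q≤x , Vx≤VN))

    ∈ys⇒InY : ∀ {c} → c ∈ ys → InY (w ⟨$⟩ˡ c)
    ∈ys⇒InY {c} c∈ with ∈-filter⁻ YValue? {xs = allFin (suc n)} (subst (c ∈_) (sym Ylist≡) (there c∈))
    ... | _ , q≤ , c≤ = q≤ , subst (_≤ V N) (sym (cong toℕ (inverseʳ w))) c≤

    wbar-next : ∀ {x} → InY x → NextInCycle ys (w ⟨$⟩ʳ x) (wbar w ⟨$⟩ʳ x)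
    wbar-next {x} x∈Y = subst (NextInCycle ys (w ⟨$⟩ʳ x)) (sym (foldl-swapVals w ys x))
                              (cycleThrough-next ys-ascending (value-InY x∈Y))

    wbar-raised : ∀ {x} → Raised x → wbar w ⟨$⟩ʳ x ∈ ys × V x < toℕ (wbar w ⟨$⟩ʳ x)
                  × (∀ {s} → s ∈ ys → V x < toℕ s → toℕ (wbar w ⟨$⟩ʳ x) ≤ toℕ s)
    wbar-raised {x} (x∈Y , x≢N) with wbar-next x∈Y
    ... | inj₂ next = next
    ... | inj₁ (_ , ys≤Vx) = ⊥-elim (x≢N (V-injective (≤-antisym (proj₂ x∈Y) VN≤Vx)))
      where
      VN≤Vx : V N ≤ V x
      VN≤Vx with value-InY N-InY
      ... | here wN≡0 = subst (_≤ V x) (sym (cong toℕ wN≡0)) z≤n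
      ... | there wN∈ = All.lookup ys≤Vx wN∈

  wbar-isYShift : IsYShift (λ x → toℕ (wbar w ⟨$⟩ʳ x))
  wbar-isYShift = record
    { fixes  = fixes
    ; last   = last
    ; raises = λ r → proj₁ (proj₂ (wbar-raised r))
    ; hits   = λ r → w ⟨$⟩ˡ _ , ∈ys⇒InY (proj₁ (wbar-raised r)) , cong toℕ (inverseʳ w)
    ; least  = least
    }
    where
    fixes : ∀ {x} → ¬ InY x → toℕ (wbar w ⟨$⟩ʳ x) ≡ V x
    fixes {x} x∉Y = cong toℕ (trans (foldl-swapVals w ys x) (cycleThrough-fixes ys-ascending wx≢0 wx∉ys))
      where
      wx≢0 : w ⟨$⟩ʳ x ≢ zero
      wx≢0 wx≡0 = x∉Y (subst InY (trans (cong (w ⟨$⟩ˡ_) (sym wx≡0)) (inverseˡ w)) q-InY)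
      wx∉ys : w ⟨$⟩ʳ x ∉ ys
      wx∉ys wx∈ = x∉Y (subst InY (inverseˡ w) (∈ys⇒InY wx∈))

    last : toℕ (wbar w ⟨$⟩ʳ N) ≡ 0
    last with wbar-next N-InY
    ... | inj₁ (wbarN≡0 , _) = cong toℕ wbarN≡0
    ... | inj₂ (c∈ , VN<c , _) =
          ⊥-elim (<⇒≱ VN<c (subst (_≤ V N) (cong toℕ (inverseʳ w)) (proj₂ (∈ys⇒InY c∈))))

    least : ∀ {x z} → Raised x → InY z → V x < V z → toℕ (wbar w ⟨$⟩ʳ x) ≤ V z
    least r z∈Y Vx<Vz with value-InY z∈Y
    ... | here wz≡0 = ⊥-elim (<⇒≱ Vx<Vz (subst (_≤ _) (sym (cong toℕ wz≡0)) z≤n))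
    ... | there wz∈ = proj₂ (proj₂ (wbar-raised r)) wz∈ Vx<Vz

module Avoidance {n : ℕ} (h : Fin (suc n) → Fin (suc n)) (w : Permutation′ (suc n))
  (hessenberg : IsHessenberg (suc n) h) (generator : IsGenerator h w) (avoids : AvoidsAll h w)
  (w̄ : Permutation′ (suc n)) (shift : YSet.IsYShift w (λ x → toℕ (w̄ ⟨$⟩ʳ x))) where

  open YSet w
  open IsYShift shift
  open IsHessenberg hessenberg using () renaming (monotone to h-mono)

  W : Fin (suc n) → ℕ
  W x = toℕ (w̄ ⟨$⟩ʳ x)

  private
    variable
      a b c i j k l x y z : Fin (suc n)

    w-avoids2143 = proj₁ avoids
    w-avoids1324 = proj₁ (proj₂ avoids)
    w-avoids1243 = proj₁ (proj₂ (proj₂ avoids))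
    w-avoids2134 = proj₁ (proj₂ (proj₂ (proj₂ avoids)))
    w-avoids1423 = proj₁ (proj₂ (proj₂ (proj₂ (proj₂ avoids))))
    w-avoids2314 = proj₁ (proj₂ (proj₂ (proj₂ (proj₂ (proj₂ avoids)))))
    w-avoids2413 = proj₂ (proj₂ (proj₂ (proj₂ (proj₂ (proj₂ avoids)))))

  consecutive⇒≤h : suc (V a) ≡ V b → b Fin.≤ h a
  consecutive⇒≤h {a} {b} 1+Va≡Vb = subst (Fin._≤ h a) (V-injective V[b′]≡V[b]) (generator a 1+Va<1+n)
    where
    1+Va<1+n = subst (_< suc n) (sym 1+Va≡Vb) (toℕ<n (w ⟨$⟩ʳ b))
    V[b′]≡V[b] = trans (cong toℕ (inverseʳ w)) (trans (toℕ-fromℕ< 1+Va<1+n) 1+Va≡Vb)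

  <⇒≢N : x Fin.< y → x ≢ N
  <⇒≢N {y = y} x<y refl = <⇒≱ x<y (≤fromℕ y)

  W<⇒≢N : W a < W b → b ≢ N
  W<⇒≢N {a} Wa<Wb refl = <⇒≱ Wa<Wb (subst (_≤ W a) (sym last) z≤n)

  V-≢ : a Fin.< b → V a ≢ V b
  V-≢ a<b Va≡Vb = <-irrefl (cong toℕ (V-injective Va≡Vb)) a<b

  crossing : ∀ d {x e} (B : Fin (suc n)) → V e ≡ d + V x → x Fin.≤ B → B Fin.< e →
             ∃₂ λ e₁ e₂ → V x ≤ V e₁ × V e₁ < V e₂ × e₂ Fin.≤ h e₁ × e₁ Fin.≤ B × B Fin.< e₂
  crossing zero B Ve≡Vx x≤B B<e =
    ⊥-elim (<⇒≱ B<e (subst (Fin._≤ B) (V-injective (sym Ve≡Vx)) x≤B))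
  crossing (suc d) {x} {e} B Ve≡1+d+Vx x≤B B<e with V-surjective d+Vx<1+n
    where d+Vx<1+n = <-trans (n<1+n (d + V x)) (subst (_< suc n) Ve≡1+d+Vx (toℕ<n (w ⟨$⟩ʳ e)))
  ... | e′ , Ve′≡d+Vx with toℕ e′ ℕ.≤? toℕ B
  ...   | yes e′≤B = e′ , e , subst (V x ≤_) (sym Ve′≡d+Vx) (m≤n+m (V x) d) ,
                     subst (_< V e) (sym Ve′≡d+Vx) (subst (d + V x <_) (sym Ve≡1+d+Vx) (n<1+n _)) ,
                     consecutive⇒≤h (trans (cong suc Ve′≡d+Vx) (sym Ve≡1+d+Vx)) , e′≤B , B<e
  ...   | no  e′≰B = crossing d B Ve′≡d+Vx x≤B (≰⇒> e′≰B)

  V≤W : x ≢ N → V x ≤ W x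
  V≤W {x} x≢N with InY? x
  ... | yes x∈Y = <⇒≤ (raises (x∈Y , x≢N))
  ... | no  x∉Y = ≤-reflexive (sym (fixes x∉Y))

  outside-after-q : q Fin.≤ x → ¬ InY x → V N < V x
  outside-after-q q≤x x∉Y = ≰⇒> (λ Vx≤VN → x∉Y (q≤x , Vx≤VN))

  outside-before-q : ¬ InY x → V x ≤ V N → x Fin.< q
  outside-before-q x∉Y Vx≤VN = ≰⇒> (λ q≤x → x∉Y (q≤x , Vx≤VN))

  succ : Raised x → Fin (suc n)
  succ r = proj₁ (hits r)

  succ-InY : (r : Raised x) → InY (succ r)
  succ-InY r = proj₁ (proj₂ (hits r))

  V[succ]≡W : (r : Raised x) → V (succ r) ≡ W x
  V[succ]≡W r = proj₂ (proj₂ (hits r))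

  W≤V[N] : Raised x → W x ≤ V N
  W≤V[N] r = subst (_≤ V N) (V[succ]≡W r) (proj₂ (succ-InY r))

  gap-before-q : Raised x → V x < V y → V y < W x → y Fin.< q
  gap-before-q r Vx<Vy Vy<Wx =
    ≰⇒> λ q≤y → <⇒≱ Vy<Wx (least r (q≤y , ≤-trans (<⇒≤ Vy<Wx) (W≤V[N] r)) Vx<Vy)

  record GapTop {x} (r : Raised x) : Set where
    field
      top          : Fin (suc n)
      suc-V[top]≡W : suc (V top) ≡ W x
      x-or-before-q : top ≡ x ⊎ top Fin.< q

  gapTop : (r : Raised x) → GapTop r
  gapTop {x} r = go (W x) refl (raises r)
    where
    go : ∀ t → W x ≡ t → V x < t → GapTop r
    go (suc t) Wx≡1+t Vx<1+t = record
      { top = top ; suc-V[top]≡W = trans (cong suc Vtop≡t) (sym Wx≡1+t) ; x-or-before-q = position }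
      where
      t<1+n : t < suc n
      t<1+n = <-trans (n<1+n t) (subst (_< suc n) (trans (V[succ]≡W r) Wx≡1+t) (toℕ<n (w ⟨$⟩ʳ succ r)))
      top = proj₁ (V-surjective t<1+n)
      Vtop≡t = proj₂ (V-surjective t<1+n)
      position : top ≡ x ⊎ top Fin.< q
      position with <-cmp (V x) t
      ... | tri< Vx<t _ _ = inj₂ (gap-before-q r (subst (V x <_) (sym Vtop≡t) Vx<t)
                                  (subst (_< W x) (sym Vtop≡t) (subst (t <_) (sym Wx≡1+t) (n<1+n t))))
      ... | tri≈ _ Vx≡t _ = inj₁ (V-injective (trans Vtop≡t (sym Vx≡t)))
      ... | tri> _ _ t<Vx = ⊥-elim (<⇒≱ t<Vx (≤-pred Vx<1+t))

  module _ {x} {r : Raised x} (t : GapTop r) where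
    open GapTop t

    succ≤h[top] : succ r Fin.≤ h top
    succ≤h[top] = consecutive⇒≤h (trans suc-V[top]≡W (sym (V[succ]≡W r)))

    top≤x : top Fin.≤ x
    top≤x with x-or-before-q
    ... | inj₁ refl    = ≤-refl
    ... | inj₂ top<q   = ≤-trans (<⇒≤ top<q) (proj₁ (proj₁ r))

    top-before-q : ∀ {y} → V x < V y → V y < W x → top Fin.< q
    top-before-q {y} Vx<Vy Vy<Wx with x-or-before-q
    ... | inj₂ top<q = top<q
    ... | inj₁ refl  = ⊥-elim (<⇒≱ Vy<Wx (subst (_≤ V y) suc-V[top]≡W Vx<Vy))

    top<x : ∀ {y} → V x < V y → V y < W x → top Fin.< x
    top<x Vx<Vy Vy<Wx = <-≤-trans (top-before-q Vx<Vy Vy<Wx) (proj₁ (proj₁ r))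

    below-W⇒≤V[top] : ∀ {y} → V y < W x → V y ≤ V top
    below-W⇒≤V[top] {y} Vy<Wx = ≤-pred (subst (V y <_) (sym suc-V[top]≡W) Vy<Wx)

    V[top]<V[succ] : V top < V (succ r)
    V[top]<V[succ] = subst (V top <_) (trans suc-V[top]≡W (sym (V[succ]≡W r))) (n<1+n (V top))

  succ≤h-self : (r : Raised x) → succ r Fin.≤ h x
  succ≤h-self r = ≤-trans (succ≤h[top] t) (h-mono (top≤x t)) where t = gapTop r

  succ≤h-after-q : (r : Raised x) → V x < V y → V y < W x → q Fin.≤ z → succ r Fin.≤ h z
  succ≤h-after-q r Vx<Vy Vy<Wx q≤z =
    ≤-trans (succ≤h[top] t) (h-mono (<⇒≤ (<-≤-trans (top-before-q t Vx<Vy Vy<Wx) q≤z)))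
    where t = gapTop r

  -- If succ r lay beyond x, the values V x, …, V N would cross back over succ r at some consecutive
  -- pair, and the generator property turns that crossing into a [1324]_h pattern.
  succ-before : (r : Raised a) → InY x → a Fin.< x → W a < V x → succ r Fin.< x
  succ-before {a} {x} r x∈Y a<x Wa<Vx =
    Finₚ.≤∧≢⇒< (≮⇒≥ λ x<s → jump x<s (crossing (V N ∸ V x) s (sym (m∸n+n≡m (proj₂ x∈Y))) (<⇒≤ x<s) s<N))
               (λ s≡x → <-irrefl (cong V s≡x) Vs<Vx)
    where
    s = succ r
    Vs<Vx : V s < V x
    Vs<Vx = subst (_< V x) (sym (V[succ]≡W r)) Wa<Vx
    Va<Vs : V a < V s
    Va<Vs = subst (V a <_) (sym (V[succ]≡W r)) (raises r)
    s<N : s Fin.< N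
    s<N = Finₚ.≤∧≢⇒< (≤fromℕ s) λ s≡N → <⇒≱ (<-≤-trans Vs<Vx (proj₂ x∈Y)) (≤-reflexive (cong V (sym s≡N)))
    jump : x Fin.< s → (∃₂ λ e₁ e₂ → V x ≤ V e₁ × V e₁ < V e₂ × e₂ Fin.≤ h e₁ × e₁ Fin.≤ s × s Fin.< e₂) → ⊥
    jump x<s (e₁ , e₂ , Vx≤Ve₁ , Ve₁<Ve₂ , e₂≤h[e₁] , e₁≤s , s<e₂) with toℕ e₁ ℕ.≤? toℕ x
    ... | yes e₁≤x = w-avoids1324 (a , x , s , e₂ , a<x , x<s , s<e₂ , ≤-trans e₂≤h[e₁] (h-mono e₁≤x) ,
                                 succ≤h-self r , Va<Vs , Vs<Vx , ≤-<-trans Vx≤Ve₁ Ve₁<Ve₂)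
    ... | no  e₁≰x = w-avoids1324 (a , e₁ , s , e₂ , <-trans a<x (≰⇒> e₁≰x) , e₁<s , s<e₂ , e₂≤h[e₁] ,
                                 succ≤h-self r , Va<Vs , <-≤-trans Vs<Vx Vx≤Ve₁ , Ve₁<Ve₂)
      where
      e₁<s = Finₚ.≤∧≢⇒< e₁≤s λ e₁≡s → <⇒≱ (<-≤-trans Vs<Vx Vx≤Ve₁) (≤-reflexive (cong V e₁≡s))

  private
    EarlierBelow : Fin (suc n) → Fin (suc n) → Set
    EarlierBelow x p = InY p × V p < V x × p Fin.< x

    -- Induction on V x: the greatest p ∈ Y before x and below V x has W p = V x by succ-before,
    -- so p, z is an inversion with smaller top value.
    no-inversion : ∀ b → V x < b → InY x → InY z → x Fin.< z → V z < V x → ⊥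
    no-inversion {x} {z} (suc b) Vx<1+b x∈Y z∈Y x<z Vz<Vx = step (greatest D? V q∈D)
      where
      D? : ∀ p → Dec (EarlierBelow x p)
      D? p = InY? p ×-dec (V p ℕ.<? V x ×-dec toℕ p ℕ.<? toℕ x)
      0<Vx = ≤-<-trans z≤n Vz<Vx
      q∈D : EarlierBelow x q
      q∈D = q-InY , subst (_< V x) (sym V[q]≡0) 0<Vx ,
            Finₚ.≤∧≢⇒< (proj₁ x∈Y) λ q≡x → <-irrefl (trans (sym V[q]≡0) (cong V q≡x)) 0<Vx
      step : (∃ λ p → EarlierBelow x p × (∀ {p′} → EarlierBelow x p′ → V p′ ≤ V p)) → ⊥
      step (p , (p∈Y , Vp<Vx , p<x) , p-greatest) with m≤n⇒m<n∨m≡n (least (p∈Y , <⇒≢N p<x) x∈Y Vp<Vx)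
      ... | inj₁ Wp<Vx = <⇒≱ (subst (V p <_) (sym (V[succ]≡W r)) (raises r))
                             (p-greatest (succ-InY r , subst (_< V x) (sym (V[succ]≡W r)) Wp<Vx ,
                                          succ-before r x∈Y p<x Wp<Vx))
        where r = (p∈Y , <⇒≢N p<x)
      ... | inj₂ Wp≡Vx with <-cmp (V p) (V z)
      ...   | tri< Vp<Vz _ _ = <⇒≱ Vz<Vx (subst (_≤ V z) Wp≡Vx (least (p∈Y , <⇒≢N p<x) z∈Y Vp<Vz))
      ...   | tri≈ _ Vp≡Vz _ = V-≢ (<-trans p<x x<z) Vp≡Vz
      ...   | tri> _ _ Vz<Vp =
        no-inversion b (<-≤-trans Vp<Vx (≤-pred Vx<1+b)) p∈Y z∈Y (<-trans p<x x<z) Vz<Vp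

  InY-increasing : InY x → InY z → x Fin.< z → V x < V z
  InY-increasing {x} {z} x∈Y z∈Y x<z with <-cmp (V x) (V z)
  ... | tri< Vx<Vz _ _ = Vx<Vz
  ... | tri≈ _ Vx≡Vz _ = ⊥-elim (V-≢ x<z Vx≡Vz)
  ... | tri> _ _ Vz<Vx = ⊥-elim (no-inversion (suc (V x)) ≤-refl x∈Y z∈Y x<z Vz<Vx)

  InY-reflects : InY x → InY z → V x < V z → x Fin.< z
  InY-reflects {x} {z} x∈Y z∈Y Vx<Vz with <-cmp (toℕ x) (toℕ z)
  ... | tri< x<z _ _ = x<z
  ... | tri≈ _ x≡z _ = ⊥-elim (<-irrefl (cong V (toℕ-injective x≡z)) Vx<Vz)
  ... | tri> _ _ z<x = ⊥-elim (<-asym Vx<Vz (InY-increasing z∈Y x∈Y z<x))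

  x<succ : (r : Raised x) → x Fin.< succ r
  x<succ r = InY-reflects (proj₁ r) (succ-InY r) (subst (_ <_) (sym (V[succ]≡W r)) (raises r))

  succ-first : (r : Raised x) → InY z → x Fin.< z → succ r Fin.≤ z
  succ-first {x} {z} r z∈Y x<z with <-cmp (V (succ r)) (V z)
  ... | tri< Vs<Vz _ _ = <⇒≤ (InY-reflects (succ-InY r) z∈Y Vs<Vz)
  ... | tri≈ _ Vs≡Vz _ = ≤-reflexive (cong toℕ (V-injective Vs≡Vz))
  ... | tri> _ _ Vz<Vs = ⊥-elim (<⇒≱ Vz<Vs (subst (_≤ V z) (sym (V[succ]≡W r))
                                              (least r z∈Y (InY-increasing (proj₁ r) z∈Y x<z))))

  W-increasing : Raised x → z ≢ N → x Fin.< z → W x < W z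
  W-increasing {x} {z} r z≢N x<z with InY? z
  ... | yes z∈Y = ≤-<-trans (least r z∈Y (InY-increasing (proj₁ r) z∈Y x<z)) (raises (z∈Y , z≢N))
  ... | no  z∉Y = subst (W x <_) (sym (fixes z∉Y))
                    (≤-<-trans (W≤V[N] r) (outside-after-q (≤-trans (proj₁ (proj₁ r)) (<⇒≤ x<z)) z∉Y))

  descent⇒fixed : x Fin.< z → z ≢ N → W z < W x → W x ≡ V x
  descent⇒fixed {x} x<z z≢N Wz<Wx with InY? x
  ... | yes x∈Y = ⊥-elim (<-asym Wz<Wx (W-increasing (x∈Y , <⇒≢N x<z) z≢N x<z))
  ... | no  x∉Y = fixes x∉Y

  V<V-after-InY : InY x → x Fin.< z → V x ≤ W z → V x < V z
  V<V-after-InY {x} {z} x∈Y x<z Vx≤Wz with InY? z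
  ... | yes z∈Y = InY-increasing x∈Y z∈Y x<z
  ... | no  z∉Y = ≤∧≢⇒< (subst (V x ≤_) (fixes z∉Y) Vx≤Wz) (V-≢ x<z)

  Y-predecessor : ¬ InY i → V i ≤ V N → ∃₂ λ p (r : Raised p) → V p < V i × V i < W p
  Y-predecessor {i} i∉Y Vi≤VN = step (greatest D? V q∈D)
    where
    D : Fin (suc n) → Set
    D p = InY p × V p < V i
    D? : ∀ p → Dec (D p)
    D? p = InY? p ×-dec (V p ℕ.<? V i)
    q∈D : D q
    q∈D = q-InY , ≤∧≢⇒< (subst (_≤ V i) (sym V[q]≡0) z≤n)
                         (λ Vq≡Vi → i∉Y (subst InY (V-injective Vq≡Vi) q-InY))
    step : (∃ λ p → D p × (∀ {p′} → D p′ → V p′ ≤ V p)) → ∃₂ λ p (r : Raised p) → V p < V i × V i < W p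
    step (p , (p∈Y , Vp<Vi) , p-greatest) = p , r , Vp<Vi , Vi<Wp
      where
      r : Raised p
      r = p∈Y , λ { refl → <⇒≱ Vp<Vi Vi≤VN }
      Vi<Wp : V i < W p
      Vi<Wp with <-cmp (W p) (V i)
      ... | tri< Wp<Vi _ _ = ⊥-elim (<⇒≱ (subst (V p <_) (sym (V[succ]≡W r)) (raises r))
                                         (p-greatest (succ-InY r , subst (_< V i) (sym (V[succ]≡W r)) Wp<Vi)))
      ... | tri≈ _ Wp≡Vi _ = ⊥-elim (i∉Y (subst InY (V-injective (trans (V[succ]≡W r) Wp≡Vi)) (succ-InY r)))
      ... | tri> _ _ Vi<Wp = Vi<Wp

  -- The value gap between V b and W b is nonempty, so its top lies before q; if the top lies after c,
  -- then c, the top, b and succ r form [1324]_h (when V c < V b) or [2314]_h (when V b < V c and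
  -- succ r > h c).
  succ≤h : (r : Raised b) → c Fin.< b → b Fin.≤ h c → V c < W b → V b < V y → V y < W b →
           succ r Fin.≤ h c
  succ≤h {b} {c} {y} r c<b b≤hc Vc<Wb Vb<Vy Vy<Wb = via (gapTop r)
    where
    via : GapTop r → succ r Fin.≤ h c
    via t with toℕ (GapTop.top t) ℕ.≤? toℕ c
    ... | yes top≤c = ≤-trans (succ≤h[top] t) (h-mono top≤c)
    ... | no  top≰c with <-cmp (V c) (V b)
    ...   | tri< Vc<Vb _ _ = ⊥-elim (w-avoids1324 (c , _ , b , succ r , ≰⇒> top≰c , top<x t Vb<Vy Vy<Wb ,
                                  x<succ r , succ≤h[top] t , b≤hc , Vc<Vb ,
                                  <-≤-trans Vb<Vy (below-W⇒≤V[top] t Vy<Wb) , V[top]<V[succ] t))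
    ...   | tri≈ _ Vc≡Vb _ = ⊥-elim (V-≢ c<b Vc≡Vb)
    ...   | tri> _ _ Vb<Vc with toℕ (succ r) ℕ.≤? toℕ (h c)
    ...     | yes s≤hc = s≤hc
    ...     | no  s≰hc = ⊥-elim (w-avoids2314 (c , _ , b , succ r , c<top , top<x t Vb<Vy Vy<Wb ,
                                  x<succ r , succ≤h[top] t , b≤hc , ≰⇒> s≰hc , Vb<Vc ,
                                  ≤∧≢⇒< (below-W⇒≤V[top] t Vc<Wb) (V-≢ c<top) , V[top]<V[succ] t))
      where c<top = ≰⇒> top≰c

  -- In w, an entry b of a pattern of w̄ lying above an earlier entry a is replaced by b itself or, when
  -- w̄ has raised b past V a, by succ r.
  record Lift (c a b : Fin (suc n)) : Set where
    constructor lifted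
    field
      pos   : Fin (suc n)
      b≤pos : b Fin.≤ pos
      pos≤h : pos Fin.≤ h c
      a<pos : V a < V pos
      pos≤W : V pos ≤ W b
      moved : pos ≡ b ⊎ Σ (Raised b) λ r → V b < V a × pos ≡ succ r

  lift : c Fin.< b → b Fin.≤ h c → V c ≤ V a → a Fin.< b → W a < W b → Lift c a b
  lift {c} {b} {a} c<b b≤hc Vc≤Va a<b Wa<Wb with InY? b
  ... | no b∉Y = record { pos = b ; b≤pos = ≤-refl ; pos≤h = b≤hc
                        ; a<pos = ≤-<-trans (V≤W (<⇒≢N a<b)) (subst (W a <_) (fixes b∉Y) Wa<Wb)
                        ; pos≤W = ≤-reflexive (sym (fixes b∉Y)) ; moved = inj₁ refl }
  ... | yes b∈Y with <-cmp (V a) (V b)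
  ...   | tri< Va<Vb _ _ = record { pos = b ; b≤pos = ≤-refl ; pos≤h = b≤hc ; a<pos = Va<Vb
                                  ; pos≤W = V≤W (W<⇒≢N Wa<Wb) ; moved = inj₁ refl }
  ...   | tri≈ _ Va≡Vb _ = ⊥-elim (V-≢ a<b Va≡Vb)
  ...   | tri> _ _ Vb<Va = record
          { pos = succ r ; b≤pos = <⇒≤ (x<succ r)
          ; pos≤h = succ≤h r c<b b≤hc (≤-<-trans Vc≤Va Va<Wb) Vb<Va Va<Wb
          ; a<pos = subst (V a <_) (sym (V[succ]≡W r)) Va<Wb
          ; pos≤W = ≤-reflexive (V[succ]≡W r) ; moved = inj₂ (r , Vb<Va , refl) }
    where
    r : Raised b
    r = b∈Y , W<⇒≢N Wa<Wb
    Va<Wb : V a < W b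
    Va<Wb = subst (_< W b) Wa≡Va Wa<Wb
      where
      Wa≡Va : W a ≡ V a
      Wa≡Va with InY? a
      ... | yes a∈Y = ⊥-elim (<-asym Vb<Va (InY-increasing a∈Y b∈Y a<b))
      ... | no  a∉Y = fixes a∉Y

  lift-self : a Fin.< b → b Fin.≤ h a → W a < W b → Lift a a b
  lift-self a<b b≤ha = lift a<b b≤ha ≤-refl a<b

  avoids2143 : ¬ Contains2143 h w̄
  avoids2143 (i , j , k , l , i<j , j<k , k<l , l≤hi , Wj<Wi , Wi<Wl , Wl<Wk)
    with lift-self (<-trans i<j (<-trans j<k k<l)) l≤hi Wi<Wl
  ... | lifted l′ l≤l′ l′≤hi Vi<Vl′ Vl′≤Wl _ =
    w-avoids2143 (i , j , k , l′ , i<j , j<k , <-≤-trans k<l l≤l′ , l′≤hi , Vj<Vi , Vi<Vl′ ,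
                  ≤-<-trans Vl′≤Wl (subst (W l <_) (descent⇒fixed k<l (W<⇒≢N Wi<Wl) Wl<Wk) Wl<Wk))
    where
    Vj<Vi = ≤-<-trans (V≤W (<⇒≢N j<k)) (subst (W j <_) (descent⇒fixed i<j (<⇒≢N j<k) Wj<Wi) Wj<Wi)

  avoids1324 : ¬ Contains1324 h w̄
  avoids1324 (i , j , k , l , i<j , j<k , k<l , l≤hj , k≤hi , Wi<Wk , Wk<Wj , Wj<Wl) =
    finish (lift-self (<-trans i<j j<k) k≤hi Wi<Wk) (lift-self (<-trans j<k k<l) l≤hj Wj<Wl)
    where
    Wk<Vj : W k < V j
    Wk<Vj = subst (W k <_) (descent⇒fixed j<k (<⇒≢N k<l) Wk<Wj) Wk<Wj
    finish : Lift i i k → Lift j j l → ⊥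
    finish (lifted k′ k≤k′ k′≤hi Vi<Vk′ Vk′≤Wk k-moved) (lifted l′ l≤l′ l′≤hj Vj<Vl′ _ _)
      with <-cmp (toℕ k′) (toℕ l′)
    ... | tri< k′<l′ _ _ = w-avoids1324 (i , j , k′ , l′ , i<j , <-≤-trans j<k k≤k′ , k′<l′ , l′≤hj , k′≤hi ,
                                         Vi<Vk′ , ≤-<-trans Vk′≤Wk Wk<Vj , Vj<Vl′)
    ... | tri≈ _ k′≡l′ _ = <-asym (≤-<-trans Vk′≤Wk Wk<Vj)
                                  (subst (V j <_) (cong V (sym (toℕ-injective k′≡l′))) Vj<Vl′)
    ... | tri> _ _ l′<k′ with k-moved
    ...   | inj₁ refl = <-asym l′<k′ (<-≤-trans k<l l≤l′)
    ...   | inj₂ (_ , Vk<Vi , _) =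
      w-avoids2143 (i , k , l′ , k′ , <-trans i<j j<k , <-≤-trans k<l l≤l′ , l′<k′ , k′≤hi ,
                    Vk<Vi , Vi<Vk′ , <-trans (≤-<-trans Vk′≤Wk Wk<Vj) Vj<Vl′)

  avoids1243 : ¬ Contains1243 h w̄
  avoids1243 (i , j , k , l , i<j , j<k , k<l , l≤hj , j≤hi , hi<l , Wi<Wj , Wj<Wl , Wl<Wk) =
    finish (lift-self i<j j≤hi Wi<Wj)
    where
    Wl<Vk : W l < V k
    Wl<Vk = subst (W l <_) (descent⇒fixed k<l (W<⇒≢N Wj<Wl) Wl<Wk) Wl<Wk
    finish : Lift i i j → ⊥
    finish (lifted _ _ _ Vi<Vj _ (inj₁ refl)) with lift-self (<-trans j<k k<l) l≤hj Wj<Wl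
    ... | lifted l′ l≤l′ l′≤hj Vj<Vl′ Vl′≤Wl _ =
      w-avoids1243 (i , j , k , l′ , i<j , j<k , <-≤-trans k<l l≤l′ , l′≤hj , j≤hi , <-≤-trans hi<l l≤l′ ,
                    Vi<Vj , Vj<Vl′ , ≤-<-trans Vl′≤Wl Wl<Vk)
    finish (lifted _ j≤s s≤hi Vi<Vs Vs≤Wj (inj₂ (r , Vj<Vi , refl))) with <-cmp (toℕ (succ r)) (toℕ k)
    ... | tri< s<k _ _ =
      w-avoids1243 (i , succ r , k , l , <-≤-trans i<j j≤s , s<k , k<l , ≤-trans l≤hj (h-mono j≤s) , s≤hi , hi<l ,
                    Vi<Vs , V<V-after-InY (succ-InY r) (<-trans s<k k<l) (≤-trans Vs≤Wj (<⇒≤ Wj<Wl)) ,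
                    ≤-<-trans (V≤W (W<⇒≢N Wj<Wl)) Wl<Vk)
    ... | tri≈ _ s≡k _ = <-irrefl (cong V (toℕ-injective s≡k)) (≤-<-trans Vs≤Wj (<-trans Wj<Wl Wl<Vk))
    ... | tri> _ _ k<s = w-avoids2143 (i , j , k , succ r , i<j , j<k , k<s , s≤hi , Vj<Vi , Vi<Vs ,
                                       ≤-<-trans Vs≤Wj (<-trans Wj<Wl Wl<Vk))

  avoids2134 : ¬ Contains2134 h w̄
  avoids2134 (i , j , k , l , i<j , j<k , k<l , l≤hk , k≤hi , hi<l , Wj<Wi , Wi<Wk , Wk<Wl) =
    finish (lift-self (<-trans i<j j<k) k≤hi Wi<Wk)
    where
    Vj<Vi : V j < V i
    Vj<Vi = ≤-<-trans (V≤W (<⇒≢N j<k)) (subst (W j <_) (descent⇒fixed i<j (<⇒≢N j<k) Wj<Wi) Wj<Wi)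
    finish : Lift i i k → ⊥
    finish (lifted _ _ _ Vi<Vk _ (inj₁ refl)) with lift-self k<l l≤hk Wk<Wl
    ... | lifted l′ l≤l′ l′≤hk Vk<Vl′ _ _ =
      w-avoids2134 (i , j , k , l′ , i<j , j<k , <-≤-trans k<l l≤l′ , l′≤hk , k≤hi , <-≤-trans hi<l l≤l′ ,
                    Vj<Vi , Vi<Vk , Vk<Vl′)
    finish (lifted _ k≤s s≤hi Vi<Vs Vs≤Wk (inj₂ (r , _ , refl))) =
      w-avoids2134 (i , j , succ r , l , i<j , <-≤-trans j<k k≤s , s<l , ≤-trans l≤hk (h-mono k≤s) , s≤hi ,
                    hi<l , Vj<Vi , Vi<Vs , V<V-after-InY (succ-InY r) s<l (≤-trans Vs≤Wk (<⇒≤ Wk<Wl)))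
      where s<l = ≤-<-trans s≤hi hi<l

  avoids2314 : ¬ Contains2314 h w̄
  avoids2314 (i , j , k , l , i<j , j<k , k<l , l≤hj , k≤hi , hi<l , Wk<Wi , Wi<Wj , Wj<Wl)
    with lift-self (<-trans j<k k<l) l≤hj Wj<Wl
  ... | lifted l′ l≤l′ l′≤hj Vj<Vl′ _ _ =
    w-avoids2314 (i , j , k , l′ , i<j , j<k , <-≤-trans k<l l≤l′ , l′≤hj , k≤hi , <-≤-trans hi<l l≤l′ ,
                  ≤-<-trans (V≤W (<⇒≢N k<l)) (subst (W k <_) Wi≡Vi Wk<Wi) , subst₂ _<_ Wi≡Vi Wj≡Vj Wi<Wj ,
                  Vj<Vl′)
    where
    Wi≡Vi = descent⇒fixed (<-trans i<j j<k) (<⇒≢N k<l) Wk<Wi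
    Wj≡Vj = descent⇒fixed j<k (<⇒≢N k<l) (<-trans Wk<Wi Wi<Wj)

  avoids2413 : ¬ Contains2413 h w̄
  avoids2413 (i , j , k , l , i<j , j≤hi , hi<k , k≤hj , hj<l , l≤hk , Wk<Wi , Wi<Wl , Wl<Wj) =
    finish (lift k<l l≤hk (<⇒≤ Vk<Vi) (<-trans (<-trans i<j j<k) k<l) Wi<Wl)
    where
    j<k = ≤-<-trans j≤hi hi<k
    k<l = ≤-<-trans k≤hj hj<l
    Vk<Vi = ≤-<-trans (V≤W (<⇒≢N k<l))
                      (subst (W k <_) (descent⇒fixed (<-trans i<j j<k) (<⇒≢N k<l) Wk<Wi) Wk<Wi)
    Wj≡Vj = descent⇒fixed j<k (<⇒≢N k<l) (<-trans Wk<Wi (<-trans Wi<Wl Wl<Wj))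
    finish : Lift k i l → ⊥
    finish (lifted l′ l≤l′ l′≤hk Vi<Vl′ Vl′≤Wl _) =
      w-avoids2413 (i , j , k , l′ , i<j , j≤hi , hi<k , k≤hj , <-≤-trans hj<l l≤l′ , l′≤hk , Vk<Vi , Vi<Vl′ ,
                    ≤-<-trans Vl′≤Wl (subst (W l <_) Wj≡Vj Wl<Wj))

  private
    -- The predecessor p of V i in Y, with its gap, yields [1324]_h if p ≤ h i and [2413]_h otherwise.
    avoids1423-last-beyond-h[j] : i Fin.< j → j Fin.< k → k Fin.< l → l Fin.≤ h j → k Fin.≤ h i →
      h i Fin.< l → (r : Raised l) → V i < V l → V l < V k → V k < W l → W l < V j → h j Fin.< succ r → ⊥
    avoids1423-last-beyond-h[j] {i} {j} {k} {l} i<j j<k k<l l≤hj k≤hi hi<l r Vi<Vl Vl<Vk Vk<Wl Wl<Vj hj<s =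
      via-predecessor (Y-predecessor i∉Y (<⇒≤ (<-≤-trans Vi<Vl (proj₂ (proj₁ r)))))
      where
      k∉Y : ¬ InY k
      k∉Y k∈Y = <-asym Vl<Vk (InY-increasing k∈Y (proj₁ r) k<l)
      i∉Y : ¬ InY i
      i∉Y i∈Y = <⇒≱ (<-≤-trans Vk<Wl (W≤V[N] r))
                     (<⇒≤ (outside-after-q (≤-trans (proj₁ i∈Y) (<⇒≤ (<-trans i<j j<k))) k∉Y))
      Vk<Vs = subst (V k <_) (sym (V[succ]≡W r)) Vk<Wl
      via-predecessor : (∃₂ λ p (r₀ : Raised p) → V p < V i × V i < W p) → ⊥
      via-predecessor (p , r₀ , Vp<Vi , Vi<Wp) = decide (toℕ p ℕ.≤? toℕ (h i))
        where
        p<l = InY-reflects (proj₁ r₀) (proj₁ r) (<-trans Vp<Vi Vi<Vl)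
        decide : Dec (p Fin.≤ h i) → ⊥
        decide (yes p≤hi) =
          w-avoids1324 (i , k , succ r₀ , succ r , <-trans i<j j<k , k<s₀ ,
                        ≤-<-trans (succ-first r₀ (proj₁ r) p<l) (x<succ r) ,
                        succ≤h r k<l (≤-trans l≤hj (h-mono (<⇒≤ j<k))) Vk<Wl Vl<Vk Vk<Wl ,
                        succ≤h r₀ i<p p≤hi Vi<Wp Vp<Vi Vi<Wp , subst (V i <_) (sym (V[succ]≡W r₀)) Vi<Wp ,
                        ≤-<-trans Vs₀≤Vl Vl<Vk , Vk<Vs)
          where
          i<p = <-≤-trans (outside-before-q i∉Y (<⇒≤ (<-≤-trans Vi<Vl (proj₂ (proj₁ r))))) (proj₁ (proj₁ r₀))
          k<s₀ = <-≤-trans (outside-before-q k∉Y (<⇒≤ (<-≤-trans Vk<Wl (W≤V[N] r)))) (proj₁ (succ-InY r₀))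
          Vs₀≤Vl = subst (_≤ V l) (sym (V[succ]≡W r₀)) (least r₀ (proj₁ r) (<-trans Vp<Vi Vi<Vl))
        decide (no p≰hi) =
          w-avoids2413 (i , j , p , succ r , i<j , <⇒≤ (<-≤-trans j<k k≤hi) , ≰⇒> p≰hi ,
                        <⇒≤ (<-≤-trans p<l l≤hj) , hj<s , succ≤h-after-q r Vl<Vk Vk<Wl (proj₁ (proj₁ r₀)) ,
                        Vp<Vi , <-trans Vi<Vl (<-trans Vl<Vk Vk<Vs) ,
                        subst (_< V j) (sym (V[succ]≡W r)) Wl<Vj)

    avoids1423-last-lifted : i Fin.< j → j Fin.< k → k Fin.< l → l Fin.≤ h j → k Fin.≤ h i → h i Fin.< l →
                             (r : Raised l) → V i < V k → V l < V k → V k < W l → W l < V j → ⊥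
    avoids1423-last-lifted {i} {j} {k} {l} i<j j<k k<l l≤hj k≤hi hi<l r Vi<Vk Vl<Vk Vk<Wl Wl<Vj =
      decide (toℕ (succ r) ℕ.≤? toℕ (h j))
      where
      Vk<Vs = subst (V k <_) (sym (V[succ]≡W r)) Vk<Wl
      Vs<Vj = subst (_< V j) (sym (V[succ]≡W r)) Wl<Vj
      decide : Dec (succ r Fin.≤ h j) → ⊥
      decide (yes s≤hj) =
        w-avoids1423 (i , j , k , succ r , i<j , j<k , <-trans k<l (x<succ r) , s≤hj , k≤hi ,
                      <-trans hi<l (x<succ r) , Vi<Vk , Vk<Vs , Vs<Vj)
      decide (no s≰hj) with <-cmp (V l) (V i)
      ... | tri< Vl<Vi _ _ = w-avoids2413 (i , j , l , succ r , i<j , <⇒≤ (<-≤-trans j<k k≤hi) , hi<l , l≤hj ,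
                                           ≰⇒> s≰hj , succ≤h-self r , Vl<Vi , <-trans Vi<Vk Vk<Vs , Vs<Vj)
      ... | tri≈ _ Vl≡Vi _ = V-≢ (<-trans (<-trans i<j j<k) k<l) (sym Vl≡Vi)
      ... | tri> _ _ Vi<Vl =
        avoids1423-last-beyond-h[j] i<j j<k k<l l≤hj k≤hi hi<l r Vi<Vl Vl<Vk Vk<Wl Wl<Vj (≰⇒> s≰hj)

  avoids1423 : ¬ Contains1423 h w̄
  avoids1423 (i , j , k , l , i<j , j<k , k<l , l≤hj , k≤hi , hi<l , Wi<Wk , Wk<Wl , Wl<Wj) =
    finish (lift-self (<-trans i<j j<k) k≤hi Wi<Wk)
    where
    Wl<Vj : W l < V j
    Wl<Vj = subst (W l <_) (descent⇒fixed j<k (<⇒≢N k<l) (<-trans Wk<Wl Wl<Wj)) Wl<Wj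
    Vl<Vj : V l < V j
    Vl<Vj = ≤-<-trans (V≤W (W<⇒≢N Wk<Wl)) Wl<Vj
    finish : Lift i i k → ⊥
    finish (lifted _ k≤s s≤hi Vi<Vs Vs≤Wk (inj₂ (r , _ , refl))) =
      w-avoids1423 (i , j , succ r , l , i<j , <-≤-trans j<k k≤s , s<l , l≤hj , s≤hi , hi<l , Vi<Vs ,
                    V<V-after-InY (succ-InY r) s<l (≤-trans Vs≤Wk (<⇒≤ Wk<Wl)) , Vl<Vj)
      where s<l = ≤-<-trans s≤hi hi<l
    finish (lifted _ _ _ Vi<Vk _ (inj₁ refl)) with lift-self k<l (≤-trans l≤hj (h-mono (<⇒≤ j<k))) Wk<Wl
    ... | lifted _ _ _ Vk<Vl _ (inj₁ refl) =
      w-avoids1423 (i , j , k , l , i<j , j<k , k<l , l≤hj , k≤hi , hi<l , Vi<Vk , Vk<Vl , Vl<Vj)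
    ... | lifted _ _ _ Vk<Vs _ (inj₂ (r , Vl<Vk , refl)) =
      avoids1423-last-lifted i<j j<k k<l l≤hj k≤hi hi<l r Vi<Vk Vl<Vk
                             (subst (V k <_) (V[succ]≡W r) Vk<Vs) Wl<Vj

  avoidsAll : AvoidsAll h w̄
  avoidsAll = avoids2143 , avoids1324 , avoids1243 , avoids2134 , avoids1423 , avoids2314 , avoids2413

proposition4p7 : (n : ℕ) (h : Fin (suc n) → Fin (suc n)) (w : Permutation′ (suc n)) →
    IsHessenberg (suc n) h → IsGenerator h w → AvoidsAll h w → AvoidsAll h (wbar w)
proposition4p7 n h w hessenberg generator avoids =
  Avoidance.avoidsAll h w hessenberg generator avoids (wbar w) (wbar-isYShift w)
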